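{- Let $f,h:\Sigma_3^*\to\Sigma_3^*$ be the morphisms $f(0)=0121,\ f(1)=021,\ f(2)=01$ and $h(0)=1210,\ h(1)=120,\ h(2)=10$. \begin{enumerate} \item Let $\mathbf{u}\in\Sigma_3^\omega$ be proper. Then some final segment (suffix) of $\mathbf{u}$ equals $f(\mathbf{v})$ for some proper $\mathbf{v}\in\Sigma_3^\omega$. \item Let $\mathbf{u}\in\Sigma_3^\omega$ be antiproper. Then some final segment of $\mathbf{u}$ equals $h(\mathbf{v})$ for some antiproper $\mathbf{v}\in\Sigma_3^\omega$. \end{enumerate}
   Context: $\Sigma_3=\{0,1,2\}$. For $u\in\Sigma_3^*$, its Parikh vector is $\pi(u)=[|u|_0,|u|_1,|u|_2]$, where $|u|_i$ is the number of occurrences of the letter $i$ in $u$. For $x,y\in\Sigma_3^*$ write $\pi(x)>\pi(y)$ if $|x|_i\ge |y|_i$ for all $i\in\Sigma_3$ and $|x|_i>|y|_i$ for at least one $i$. A finite word $u\in\Sigma_3^*$ is proper if (1) $u$ has no factor of the form $xyxyx$ with $\pi(x)>\pi(y)$, and (2) none of the words $00,11,22,20,10101,2121,10210210$ is a factor of $u$. An infinite word $\mathbf{u}\in\Sigma_3^\omega$ is proper if all its finite factors are proper. A finite word $u$ is antiproper if its reversal $u^R$ is proper; an infinite word is antiproper if all its finite factors are antiproper. A final segment of an infinite word is a suffix of it. -}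

module Defs where

open import Data.Nat using (ℕ; zero; suc; _+_; _≤_; _<_)
open import Data.List using (List; []; _∷_; _++_; length; reverse; concatMap)
open import Data.Product using (Σ; ∃; _×_; _,_)
open import Relation.Binary.PropositionalEquality using (_≡_)
open import Relation.Nullary using (¬_)

data Σ₃ : Set where
  𝟎 𝟏 𝟐 : Σ₃

Word : Set
Word = List Σ₃

ωWord : Set
ωWord = ℕ → Σ₃

count : Σ₃ → Word → ℕ
count a [] = 0
count 𝟎 (𝟎 ∷ u) = suc (count 𝟎 u)
count 𝟏 (𝟏 ∷ u) = suc (count 𝟏 u)
count 𝟐 (𝟐 ∷ u) = suc (count 𝟐 u)
count a (_ ∷ u) = count a u

_≻π_ : Word → Word → Set
x ≻π y = (∀ a → count a y ≤ count a x) × (∃ λ a → count a y < count a x)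

Factor : Word → Word → Set
Factor w u = ∃ λ p → ∃ λ s → u ≡ p ++ w ++ s

forbidden : List Word
forbidden = (𝟎 ∷ 𝟎 ∷ [])
          ∷ (𝟏 ∷ 𝟏 ∷ [])
          ∷ (𝟐 ∷ 𝟐 ∷ [])
          ∷ (𝟐 ∷ 𝟎 ∷ [])
          ∷ (𝟏 ∷ 𝟎 ∷ 𝟏 ∷ 𝟎 ∷ 𝟏 ∷ [])
          ∷ (𝟐 ∷ 𝟏 ∷ 𝟐 ∷ 𝟏 ∷ [])
          ∷ (𝟏 ∷ 𝟎 ∷ 𝟐 ∷ 𝟏 ∷ 𝟎 ∷ 𝟐 ∷ 𝟏 ∷ 𝟎 ∷ [])
          ∷ []

open import Data.List.Membership.Propositional using (_∈_)

Proper : Word → Set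
Proper u =
  (∀ x y → x ≻π y → ¬ Factor (x ++ y ++ x ++ y ++ x) u)
  × (∀ w → w ∈ forbidden → ¬ Factor w u)

Antiproper : Word → Set
Antiproper u = Proper (reverse u)

factorω : ωWord → ℕ → ℕ → Word
factorω u i zero = []
factorω u i (suc n) = u i ∷ factorω u (suc i) n

prefixω : ωWord → ℕ → Word
prefixω u n = factorω u 0 n

Properω : ωWord → Set
Properω u = ∀ i n → Proper (factorω u i n)

Antiproperω : ωWord → Set
Antiproperω u = ∀ i n → Antiproper (factorω u i n)

Morphism : Set
Morphism = Σ₃ → Word

apply : Morphism → Word → Word
apply g w = concatMap g w

-- the final segment of u starting at position k equals g(v)
-- (for non-erasing g: every g(prefix of v) is a prefix of that final segment)
SuffixImage : Morphism → ωWord → ωWord → Set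
SuffixImage g u v = ∃ λ k → ∀ n →
  factorω u k (length (apply g (prefixω v n))) ≡ apply g (prefixω v n)

f : Morphism
f 𝟎 = 𝟎 ∷ 𝟏 ∷ 𝟐 ∷ 𝟏 ∷ []
f 𝟏 = 𝟎 ∷ 𝟐 ∷ 𝟏 ∷ []
f 𝟐 = 𝟎 ∷ 𝟏 ∷ []

h : Morphism
h 𝟎 = 𝟏 ∷ 𝟐 ∷ 𝟏 ∷ 𝟎 ∷ []
h 𝟏 = 𝟏 ∷ 𝟐 ∷ 𝟎 ∷ []
h 𝟐 = 𝟏 ∷ 𝟎 ∷ []

module Submission where

-- In a proper word every 𝟎 is followed by 1210, 210 or 10 (checked on
-- all proper words of length 6), so from its first 𝟎 on a proper u splits into blocks
-- f 𝟎 = 0121, f 𝟏 = 021, f 𝟐 = 01 and equals f v. Conversely f carries obstructions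
-- in v to obstructions in u: each f a contains exactly one 𝟎, so a factor xyxyx of v
-- with π(x) > π(y) is sent to one with π(f x) > π(f y); and a forbidden factor of v,
-- flanked by two letters on each side, has an image that is checked to be improper.
-- Hence v without its first two letters is proper. The antiproper case is the same
-- argument for h and the reversed forbidden factors, cutting just after each 𝟎.

open import Defs
open import Data.Bool using (Bool; T; _∧_)
open import Data.Bool.ListAction using (all)
open import Data.Bool.Properties using (T-∧)
open import Data.List using (List; []; _∷_; _++_; length; reverse; map; take; drop; head; mapMaybe; cartesianProduct; applyUpTo; upTo)
open import Data.List.Membership.DecPropositional using (_∈?_)
open import Data.List.Membership.Propositional using (_∈_; find)
open import Data.List.Membership.Propositional.Properties using (∈-map⁺)
open import Data.List.Properties using (concatMap-++; reverse-++; unfold-reverse; reverse-involutive; ++-assoc; ∷-injective; ∷-injectiveˡ; ∷-injectiveʳ)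
open import Data.List.Relation.Binary.Pointwise using (Pointwise-≡⇒≡)
open import Data.List.Relation.Binary.Prefix.Heterogeneous using (Prefix; toView)
import Data.List.Relation.Binary.Prefix.Heterogeneous as Prefix
open import Data.List.Relation.Binary.Prefix.Heterogeneous.Properties using (prefix?)
import Data.List.Relation.Unary.All as All
open import Data.List.Relation.Unary.All.Properties using (all⁺)
open import Data.List.Relation.Unary.Any using (Any; here; there; any?)
open import Data.Maybe using (Maybe; just; nothing; is-just; _<∣>_; to-witness-T)
import Data.Maybe as Maybe
open import Data.Nat using (ℕ; zero; suc; _+_; _*_; _≤_; _<_; _≤?_; _<?_)
open import Data.Nat.Properties using (+-identityʳ; +-suc; +-comm; +-mono-≤; +-mono-<-≤; +-mono-≤-<; *-monoˡ-≤; *-monoˡ-<)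
open import Data.Nat.Tactic.RingSolver using (solve-∀)
open import Data.Product using (Σ; ∃; ∃₂; _×_; _,_; proj₁; proj₂)
open import Data.Sum using (_⊎_; inj₁; inj₂)
open import Data.Empty using (⊥-elim)
open import Function using (_∘_)
open import Function.Bundles using (Equivalence)
open import Relation.Binary.Definitions using (DecidableEquality)
open import Relation.Binary.PropositionalEquality using (_≡_; refl; sym; trans; cong; cong₂; subst; subst₂; module ≡-Reasoning)
open import Relation.Nullary using (¬_; Dec; yes; no)
open import Relation.Nullary.Decidable using (_×-dec_; _⊎-dec_; map′; dec⇒maybe)

open ≡-Reasoning

_≟_ : DecidableEquality Σ₃
𝟎 ≟ 𝟎 = yes refl
𝟎 ≟ 𝟏 = no λ ()
𝟎 ≟ 𝟐 = no λ ()
𝟏 ≟ 𝟎 = no λ ()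
𝟏 ≟ 𝟏 = yes refl
𝟏 ≟ 𝟐 = no λ ()
𝟐 ≟ 𝟎 = no λ ()
𝟐 ≟ 𝟏 = no λ ()
𝟐 ≟ 𝟐 = yes refl

∀-letter? : {P : Σ₃ → Set} → (∀ a → Dec (P a)) → Dec (∀ a → P a)
∀-letter? P? = map′ (λ (p₀ , p₁ , p₂) → λ { 𝟎 → p₀ ; 𝟏 → p₁ ; 𝟐 → p₂ }) (λ p → p 𝟎 , p 𝟏 , p 𝟐)
                    (P? 𝟎 ×-dec P? 𝟏 ×-dec P? 𝟐)

∃-letter? : {P : Σ₃ → Set} → (∀ a → Dec (P a)) → Dec (∃ P)
∃-letter? P? = map′ (λ { (inj₁ p) → 𝟎 , p ; (inj₂ (inj₁ p)) → 𝟏 , p ; (inj₂ (inj₂ p)) → 𝟐 , p })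
                    (λ { (𝟎 , p) → inj₁ p ; (𝟏 , p) → inj₂ (inj₁ p) ; (𝟐 , p) → inj₂ (inj₂ p) })
                    (P? 𝟎 ⊎-dec P? 𝟏 ⊎-dec P? 𝟐)

-- Parikh vectors

count-++ : ∀ a u w → count a (u ++ w) ≡ count a u + count a w
count-++ a [] w = refl
count-++ 𝟎 (𝟎 ∷ u) w = cong suc (count-++ 𝟎 u w)
count-++ 𝟎 (𝟏 ∷ u) w = count-++ 𝟎 u w
count-++ 𝟎 (𝟐 ∷ u) w = count-++ 𝟎 u w
count-++ 𝟏 (𝟎 ∷ u) w = count-++ 𝟏 u w
count-++ 𝟏 (𝟏 ∷ u) w = cong suc (count-++ 𝟏 u w)
count-++ 𝟏 (𝟐 ∷ u) w = count-++ 𝟏 u w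
count-++ 𝟐 (𝟎 ∷ u) w = count-++ 𝟐 u w
count-++ 𝟐 (𝟏 ∷ u) w = count-++ 𝟐 u w
count-++ 𝟐 (𝟐 ∷ u) w = cong suc (count-++ 𝟐 u w)

count-reverse : ∀ a w → count a (reverse w) ≡ count a w
count-reverse a [] = refl
count-reverse a (b ∷ w) = begin
  count a (reverse (b ∷ w))               ≡⟨ cong (count a) (unfold-reverse b w) ⟩
  count a (reverse w ++ b ∷ [])           ≡⟨ count-++ a (reverse w) (b ∷ []) ⟩
  count a (reverse w) + count a (b ∷ [])  ≡⟨ cong (_+ count a (b ∷ [])) (count-reverse a w) ⟩
  count a w + count a (b ∷ [])            ≡⟨ +-comm (count a w) _ ⟩
  count a (b ∷ []) + count a w            ≡⟨ count-++ a (b ∷ []) w ⟨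
  count a (b ∷ w)                         ∎

weight : (Σ₃ → ℕ) → Word → ℕ
weight k w = count 𝟎 w * k 𝟎 + count 𝟏 w * k 𝟏 + count 𝟐 w * k 𝟐

weight-∷ : ∀ k a w → weight k (a ∷ w) ≡ k a + weight k w
weight-∷ k 𝟎 w = shift₀ (count 𝟎 w) (count 𝟏 w) (count 𝟐 w) (k 𝟎) (k 𝟏) (k 𝟐)
  where
  shift₀ : ∀ c₀ c₁ c₂ k₀ k₁ k₂ → suc c₀ * k₀ + c₁ * k₁ + c₂ * k₂ ≡ k₀ + (c₀ * k₀ + c₁ * k₁ + c₂ * k₂)
  shift₀ = solve-∀
weight-∷ k 𝟏 w = shift₁ (count 𝟎 w) (count 𝟏 w) (count 𝟐 w) (k 𝟎) (k 𝟏) (k 𝟐)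
  where
  shift₁ : ∀ c₀ c₁ c₂ k₀ k₁ k₂ → c₀ * k₀ + suc c₁ * k₁ + c₂ * k₂ ≡ k₁ + (c₀ * k₀ + c₁ * k₁ + c₂ * k₂)
  shift₁ = solve-∀
weight-∷ k 𝟐 w = shift₂ (count 𝟎 w) (count 𝟏 w) (count 𝟐 w) (k 𝟎) (k 𝟏) (k 𝟐)
  where
  shift₂ : ∀ c₀ c₁ c₂ k₀ k₁ k₂ → c₀ * k₀ + c₁ * k₁ + suc c₂ * k₂ ≡ k₂ + (c₀ * k₀ + c₁ * k₁ + c₂ * k₂)
  shift₂ = solve-∀

length≡weight : ∀ w → length w ≡ weight (λ _ → 1) w
length≡weight [] = refl
length≡weight (a ∷ w) = trans (cong suc (length≡weight w)) (sym (weight-∷ (λ _ → 1) a w))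

count-apply : ∀ g c w → count c (apply g w) ≡ weight (count c ∘ g) w
count-apply g c [] = refl
count-apply g c (a ∷ w) = begin
  count c (g a ++ apply g w)               ≡⟨ count-++ c (g a) (apply g w) ⟩
  count c (g a) + count c (apply g w)      ≡⟨ cong (count c (g a) +_) (count-apply g c w) ⟩
  count c (g a) + weight (count c ∘ g) w   ≡⟨ weight-∷ (count c ∘ g) a w ⟨
  weight (count c ∘ g) (a ∷ w)             ∎

weight-mono-≤ : ∀ {x y} → (∀ a → count a y ≤ count a x) → ∀ k → weight k y ≤ weight k x
weight-mono-≤ y≤x k =
  +-mono-≤ (+-mono-≤ (*-monoˡ-≤ (k 𝟎) (y≤x 𝟎)) (*-monoˡ-≤ (k 𝟏) (y≤x 𝟏))) (*-monoˡ-≤ (k 𝟐) (y≤x 𝟐))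

≻π⇒length< : ∀ {x y} → x ≻π y → length y < length x
≻π⇒length< {x} {y} (y≤x , a , y<x) =
  subst₂ _<_ (sym (length≡weight y)) (sym (length≡weight x)) (strict a y<x)
  where
  strict : ∀ a → count a y < count a x → weight (λ _ → 1) y < weight (λ _ → 1) x
  strict 𝟎 lt = +-mono-<-≤ (+-mono-<-≤ (*-monoˡ-< 1 lt) (*-monoˡ-≤ 1 (y≤x 𝟏))) (*-monoˡ-≤ 1 (y≤x 𝟐))
  strict 𝟏 lt = +-mono-<-≤ (+-mono-≤-< (*-monoˡ-≤ 1 (y≤x 𝟎)) (*-monoˡ-< 1 lt)) (*-monoˡ-≤ 1 (y≤x 𝟐))
  strict 𝟐 lt = +-mono-≤-< (+-mono-≤ (*-monoˡ-≤ 1 (y≤x 𝟎)) (*-monoˡ-≤ 1 (y≤x 𝟏))) (*-monoˡ-< 1 lt)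

count-apply-uniform : ∀ {g c} → (∀ a → count c (g a) ≡ 1) → ∀ w → count c (apply g w) ≡ length w
count-apply-uniform uniform [] = refl
count-apply-uniform {g} {c} uniform (a ∷ w) =
  trans (count-++ c (g a) (apply g w)) (cong₂ _+_ (uniform a) (count-apply-uniform uniform w))

≻π-apply : ∀ {g c x y} → (∀ a → count c (g a) ≡ 1) → x ≻π y → apply g x ≻π apply g y
≻π-apply {g} {c} {x} {y} uniform x≻y@(y≤x , _) =
  (λ b → subst₂ _≤_ (sym (count-apply g b y)) (sym (count-apply g b x))
                    (weight-mono-≤ {x} {y} y≤x (count b ∘ g))) ,
  c , subst₂ _<_ (sym (count-apply-uniform uniform y)) (sym (count-apply-uniform uniform x))
                 (≻π⇒length< {x} {y} x≻y)

≻π-reverse : ∀ {x y} → x ≻π y → reverse x ≻π reverse y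
≻π-reverse {x} {y} (y≤x , a , y<x) =
  (λ b → subst₂ _≤_ (sym (count-reverse b y)) (sym (count-reverse b x)) (y≤x b)) ,
  a , subst₂ _<_ (sym (count-reverse a y)) (sym (count-reverse a x)) y<x

_≻π?_ : (x y : Word) → Dec (x ≻π y)
x ≻π? y = ∀-letter? (λ a → count a y ≤? count a x) ×-dec ∃-letter? (λ a → count a y <? count a x)

xyxyx : Word → Word → Word
xyxyx x y = x ++ y ++ x ++ y ++ x

apply-++₃ : ∀ g a b c → apply g (a ++ b ++ c) ≡ apply g a ++ apply g b ++ apply g c
apply-++₃ g a b c = trans (concatMap-++ g a (b ++ c)) (cong (apply g a ++_) (concatMap-++ g b c))

apply-xyxyx : ∀ g x y → apply g (xyxyx x y) ≡ xyxyx (apply g x) (apply g y)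
apply-xyxyx g x y =
  trans (apply-++₃ g x y (x ++ y ++ x)) (cong (λ t → apply g x ++ apply g y ++ t) (apply-++₃ g x y x))

reverse-++₃ : ∀ (a b c : Word) → reverse (a ++ b ++ c) ≡ reverse c ++ reverse b ++ reverse a
reverse-++₃ a b c = begin
  reverse (a ++ b ++ c)                  ≡⟨ reverse-++ a (b ++ c) ⟩
  reverse (b ++ c) ++ reverse a          ≡⟨ cong (_++ reverse a) (reverse-++ b c) ⟩
  (reverse c ++ reverse b) ++ reverse a  ≡⟨ ++-assoc (reverse c) (reverse b) (reverse a) ⟩
  reverse c ++ reverse b ++ reverse a    ∎

reverse-xyxyx : ∀ x y → reverse (xyxyx x y) ≡ xyxyx (reverse x) (reverse y)
reverse-xyxyx x y = begin
  reverse (x ++ y ++ (x ++ y ++ x))       ≡⟨ reverse-++₃ x y (x ++ y ++ x) ⟩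
  reverse (x ++ y ++ x) ++ rᵧ ++ rₓ       ≡⟨ cong (_++ rᵧ ++ rₓ) (reverse-++₃ x y x) ⟩
  (rₓ ++ rᵧ ++ rₓ) ++ rᵧ ++ rₓ            ≡⟨ ++-assoc rₓ (rᵧ ++ rₓ) (rᵧ ++ rₓ) ⟩
  rₓ ++ (rᵧ ++ rₓ) ++ rᵧ ++ rₓ            ≡⟨ cong (rₓ ++_) (++-assoc rᵧ rₓ (rᵧ ++ rₓ)) ⟩
  xyxyx rₓ rᵧ                             ∎
  where
  rₓ = reverse x
  rᵧ = reverse y

Factor-∷ : ∀ {z w} a → Factor z w → Factor z (a ∷ w)
Factor-∷ a (p , s , e) = a ∷ p , s , cong (a ∷_) e

Factor-apply : ∀ g {z w} → Factor z w → Factor (apply g z) (apply g w)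
Factor-apply g {z} (p , s , refl) = apply g p , apply g s , apply-++₃ g p z s

Factor-reverse : ∀ {z w} → Factor z w → Factor (reverse z) (reverse w)
Factor-reverse {z} (p , s , refl) = reverse s , reverse p , reverse-++₃ p z s

ProperWrt : List Word → Word → Set
ProperWrt F u = (∀ x y → x ≻π y → ¬ Factor (xyxyx x y) u) × (∀ w → w ∈ F → ¬ Factor w u)

ProperωWrt : List Word → ωWord → Set
ProperωWrt F u = ∀ i n → ProperWrt F (factorω u i n)

data Improper (F : List Word) (u : Word) : Set where
  forbidden-factor : ∀ {z} → z ∈ F → Factor z u → Improper F u
  xyxyx-factor     : ∀ x y → x ≻π y → Factor (xyxyx x y) u → Improper F u

improper⇒¬proper : ∀ {F u} → Improper F u → ¬ ProperWrt F u
improper⇒¬proper (forbidden-factor z∈F fz) (_ , avoids) = avoids _ z∈F fz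
improper⇒¬proper (xyxyx-factor x y x≻y fx) (free , _) = free x y x≻y fx

¬improper⇒proper : ∀ {F u} → ¬ Improper F u → ProperWrt F u
¬improper⇒proper ¬imp =
  (λ x y x≻y fx → ¬imp (xyxyx-factor x y x≻y fx)) , (λ z z∈F fz → ¬imp (forbidden-factor z∈F fz))

improper-∷ : ∀ {F w} a → Improper F w → Improper F (a ∷ w)
improper-∷ a (forbidden-factor z∈F fz) = forbidden-factor z∈F (Factor-∷ a fz)
improper-∷ a (xyxyx-factor x y x≻y fx) = xyxyx-factor x y x≻y (Factor-∷ a fx)

improper-reverse : ∀ {F u} → Improper F u → Improper (map reverse F) (reverse u)
improper-reverse (forbidden-factor z∈F fz) = forbidden-factor (∈-map⁺ reverse z∈F) (Factor-reverse fz)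
improper-reverse {u = u} (xyxyx-factor x y x≻y fx) =
  xyxyx-factor (reverse x) (reverse y) (≻π-reverse {x} {y} x≻y)
    (subst (λ t → Factor t (reverse u)) (reverse-xyxyx x y) (Factor-reverse fx))

forbiddenᴿ : List Word
forbiddenᴿ = map reverse forbidden

-- improper-reverse lands in map reverse forbiddenᴿ, which normalises to forbidden.
antiproper⇒properᴿ : ∀ {u} → Antiproper u → ProperWrt forbiddenᴿ u
antiproper⇒properᴿ anti = ¬improper⇒proper λ imp → improper⇒¬proper (improper-reverse imp) anti

properᴿ⇒antiproper : ∀ {u} → ProperWrt forbiddenᴿ u → Antiproper u
properᴿ⇒antiproper {u} proper = ¬improper⇒proper λ imp →
  improper⇒¬proper (subst (Improper forbiddenᴿ) (reverse-involutive u) (improper-reverse imp)) proper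

prefix⇒Factor : ∀ {z w} → Prefix _≡_ z w → Factor z w
prefix⇒Factor p with pw Prefix.++ s ← toView p = [] , s , cong (_++ s) (sym (Pointwise-≡⇒≡ pw))

forbiddenPrefix? : ∀ F w → Maybe (Improper F w)
forbiddenPrefix? F w = Maybe.map found (dec⇒maybe (any? (λ z → prefix? _≟_ z w) F))
  where
  found : Any (λ z → Prefix _≡_ z w) F → Improper F w
  found p with _ , z∈F , z≤w ← find p = forbidden-factor z∈F (prefix⇒Factor z≤w)

-- Only tries 1 ≤ |x| ≤ 5 and |y| ≤ 5: the search is sound but not complete.
xyxyxPrefix? : ∀ F w → Maybe (Improper F w)
xyxyxPrefix? F w = head (mapMaybe try (cartesianProduct (applyUpTo suc 5) (upTo 6)))
  where
  try : ℕ × ℕ → Maybe (Improper F w)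
  try (i , j) = Maybe.map (λ (p , x≻y) → xyxyx-factor x y x≻y (prefix⇒Factor p))
                          (dec⇒maybe (prefix? _≟_ (xyxyx x y) w ×-dec x ≻π? y))
    where
    x = take i w
    y = take j (drop i w)

atSomePosition : ∀ {F} → ((w : Word) → Maybe (Improper F w)) → (w : Word) → Maybe (Improper F w)
atSomePosition P? [] = P? []
atSomePosition P? (a ∷ w) = P? (a ∷ w) <∣> Maybe.map (improper-∷ a) (atSomePosition P? w)

improper? : ∀ F w → Maybe (Improper F w)
improper? F w = atSomePosition (forbiddenPrefix? F) w <∣> atSomePosition (xyxyxPrefix? F) w

allLetters : (Σ₃ → Bool) → Bool
allLetters p = p 𝟎 ∧ p 𝟏 ∧ p 𝟐

allLetters-sound : ∀ p → T (allLetters p) → ∀ a → T (p a)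
allLetters-sound p t 𝟎 = proj₁ (Equivalence.to (T-∧ {p 𝟎}) t)
allLetters-sound p t 𝟏 = proj₁ (Equivalence.to (T-∧ {p 𝟏}) (proj₂ (Equivalence.to (T-∧ {p 𝟎}) t)))
allLetters-sound p t 𝟐 = proj₂ (Equivalence.to (T-∧ {p 𝟏}) (proj₂ (Equivalence.to (T-∧ {p 𝟎}) t)))

allWords : ℕ → (Word → Bool) → Bool
allWords zero p = p []
allWords (suc n) p = allLetters λ a → allWords n (p ∘ (a ∷_))

allWords-sound : ∀ n p → T (allWords n p) → ∀ w → length w ≡ n → T (p w)
allWords-sound zero p t [] refl = t
allWords-sound (suc n) p t (a ∷ w) refl =
  allWords-sound n (p ∘ (a ∷_)) (allLetters-sound (λ b → allWords n (p ∘ (b ∷_))) t a) w refl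

improper-or? : ∀ F {P : Word → Set} → ((w : Word) → Maybe (P w)) →
               (w : Word) → Maybe (Improper F w ⊎ P w)
improper-or? F P? w = Maybe.map inj₂ (P? w) <∣> Maybe.map inj₁ (improper? F w)

checkOnProperWords : List Word → ℕ → {P : Word → Set} → ((w : Word) → Maybe (P w)) → Bool
checkOnProperWords F n P? = allWords n (is-just ∘ improper-or? F P?)

checkOnProperWords-sound : ∀ F n {P : Word → Set} (P? : (w : Word) → Maybe (P w)) →
                           T (checkOnProperWords F n P?) → ∀ w → length w ≡ n → Improper F w ⊎ P w
checkOnProperWords-sound F n P? t w |w| = to-witness-T (improper-or? F P? w) (allWords-sound n _ t w |w|)

ImproperInContext : Morphism → List Word → Set
ImproperInContext g F = ∀ {z} → z ∈ F → ∀ a b c d → Improper F (apply g (a ∷ b ∷ z ++ c ∷ d ∷ []))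

improperAround? : Morphism → List Word → Word → Word → Bool
improperAround? g F z w = is-just (improper? F (apply g (take 2 w ++ z ++ drop 2 w)))

checkImproperInContext : Morphism → List Word → Bool
checkImproperInContext g F = all (λ z → allWords 4 (improperAround? g F z)) F

checkImproperInContext-sound : ∀ g F → T (checkImproperInContext g F) → ImproperInContext g F
checkImproperInContext-sound g F t {z} z∈F a b c d =
  to-witness-T (improper? F (apply g (a ∷ b ∷ z ++ c ∷ d ∷ [])))
    (allWords-sound 4 (improperAround? g F z) (All.lookup (all⁺ _ F t) z∈F) (a ∷ b ∷ c ∷ d ∷ []) refl)

OccursAt : ωWord → ℕ → Word → Set
OccursAt u j w = factorω u j (length w) ≡ w

length-factorω : ∀ u j n → length (factorω u j n) ≡ n
length-factorω u j zero = refl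
length-factorω u j (suc n) = cong suc (length-factorω u (suc j) n)

factorω-occurs : ∀ u j n → OccursAt u j (factorω u j n)
factorω-occurs u j n = cong (factorω u j) (length-factorω u j n)

occursAt-++ : ∀ {u} j w₁ {w₂} → OccursAt u j w₁ → OccursAt u (j + length w₁) w₂ → OccursAt u j (w₁ ++ w₂)
occursAt-++ j [] _ o₂ rewrite +-identityʳ j = o₂
occursAt-++ {u} j (a ∷ w₁) {w₂} o₁ o₂ with refl , o₁′ ← ∷-injective o₁ =
  cong (a ∷_) (occursAt-++ (suc j) w₁ o₁′ (subst (λ k → OccursAt u k w₂) (+-suc j (length w₁)) o₂))

occursAt-++⁻ : ∀ {u} j w₁ {w₂} → OccursAt u j (w₁ ++ w₂) → OccursAt u j w₁ × OccursAt u (j + length w₁) w₂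
occursAt-++⁻ j [] o rewrite +-identityʳ j = refl , o
occursAt-++⁻ {u} j (a ∷ w₁) {w₂} o with refl , o′ ← ∷-injective o =
  let o₁ , o₂ = occursAt-++⁻ (suc j) w₁ o′
  in cong (a ∷_) o₁ , subst (λ k → OccursAt u k w₂) (sym (+-suc j (length w₁))) o₂

occursAt-factor : ∀ {u j z w} → OccursAt u j w → (fz : Factor z w) → OccursAt u (j + length (proj₁ fz)) z
occursAt-factor {j = j} o (p , s , refl) = proj₁ (occursAt-++⁻ _ _ (proj₂ (occursAt-++⁻ j p o)))

factorω-shift : ∀ v k i n → factorω (λ m → v (m + k)) i n ≡ factorω v (i + k) n
factorω-shift v k i zero = refl
factorω-shift v k i (suc n) = cong (v (i + k) ∷_) (factorω-shift v k (suc i) n)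

occursAt-shift : ∀ {v k j w} → OccursAt (λ m → v (m + k)) j w → OccursAt v (j + k) w
occursAt-shift {v} {k} {j} {w} o = trans (sym (factorω-shift v k j (length w))) o

∈-factorω : ∀ {u a} j n → a ∈ factorω u j n → ∃ λ m → u m ≡ a
∈-factorω j (suc n) (here a≡uj) = j , sym a≡uj
∈-factorω j (suc n) (there a∈) = ∈-factorω (suc j) n a∈

factorω-satisfies : ∀ {F u n} {P : Word → Set} → ProperωWrt F u →
                    (∀ w → length w ≡ n → Improper F w ⊎ P w) → ∀ j → P (factorω u j n)
factorω-satisfies {u = u} {n} proper check j with check (factorω u j n) (length-factorω u j n)
... | inj₁ improper = ⊥-elim (improper⇒¬proper improper (proper j n))
... | inj₂ p = p

-- Desubstitution

ImageAt : Morphism → ωWord → (ℕ → ℕ) → ωWord → Set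
ImageAt g u P v = ∀ i n → OccursAt u (P i) (apply g (factorω v i n))

Blocks : Morphism → ωWord → (ℕ → Set) → Set
Blocks g u Cut = ∀ {j} → Cut j → Σ Σ₃ λ a → OccursAt u j (g a) × Cut (j + length (g a))

module _ (g : Morphism) (u : ωWord) (Cut : ℕ → Set) (block : Blocks g u Cut) where

  private
    cuts : Σ ℕ Cut → ℕ → Σ ℕ Cut
    cuts c zero = c
    cuts c (suc i) with j , cj ← cuts c i = j + length (g (proj₁ (block cj))) , proj₂ (proj₂ (block cj))

    letters : Σ ℕ Cut → ωWord
    letters c i = proj₁ (block (proj₂ (cuts c i)))

    image : ∀ c → ImageAt g u (proj₁ ∘ cuts c) (letters c)
    image c i zero = refl
    image c i (suc n) =
      occursAt-++ _ (g (letters c i)) (proj₁ (proj₂ (block (proj₂ (cuts c i))))) (image c (suc i) n)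

  parse : ∃ Cut → ∃₂ λ P v → ImageAt g u P v
  parse c = proj₁ ∘ cuts c , letters c , image c

ImageAt-drop : ∀ {g u P v} k → ImageAt g u P v → ImageAt g u (λ i → P (i + k)) (λ i → v (i + k))
ImageAt-drop {g} {u} {P} {v} k img i n =
  subst (λ t → OccursAt u (P (i + k)) (apply g t)) (sym (factorω-shift v k i n)) (img (i + k) n)

ImageAt⇒SuffixImage : ∀ {g u P v} → ImageAt g u P v → SuffixImage g u v
ImageAt⇒SuffixImage {P = P} img = P 0 , img 0

ImageAt-proper : ∀ {F g u P v} → ImageAt g u P v → ProperωWrt F u →
                 ∀ i n → ProperWrt F (apply g (factorω v i n))
ImageAt-proper {F} {g} {P = P} img proper i n = subst (ProperWrt F) (img i n) (proper (P i) _)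

module _ {g : Morphism} {F : List Word} {c : Σ₃}
         (uniform : ∀ a → count c (g a) ≡ 1) (context : ImproperInContext g F) where

  xyxyx-free-preimage : ∀ {w} → ProperWrt F (apply g w) → ∀ x y → x ≻π y → ¬ Factor (xyxyx x y) w
  xyxyx-free-preimage {w} (free , _) x y x≻y fx =
    free (apply g x) (apply g y) (≻π-apply {g} {c} {x} {y} uniform x≻y)
         (subst (λ t → Factor t (apply g w)) (apply-xyxyx g x y) (Factor-apply g fx))

  -- Dropping two letters of v leaves two letters of context on both sides of every factor.
  proper-preimage : ∀ {v} → (∀ i n → ProperWrt F (apply g (factorω v i n))) → ProperωWrt F (λ i → v (i + 2))
  proper-preimage {v} imageProper i n = xyxyx-free-preimage (occurs-proper (occursAt-shift whole)) , avoids
    where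
    occurs-proper : ∀ {k w} → OccursAt v k w → ProperWrt F (apply g w)
    occurs-proper {k} {w} o = subst (λ t → ProperWrt F (apply g t)) o (imageProper k (length w))

    whole : OccursAt (λ m → v (m + 2)) i (factorω (λ m → v (m + 2)) i n)
    whole = factorω-occurs _ i n

    avoids : ∀ z → z ∈ F → ¬ Factor z (factorω (λ m → v (m + 2)) i n)
    avoids z z∈F fz =
      improper⇒¬proper (context z∈F (v k) (v (suc k)) (v r) (v (suc r))) (occurs-proper flanked)
      where
      k = i + length (proj₁ fz)
      r = k + 2 + length z
      flanked : OccursAt v k (factorω v k 2 ++ z ++ factorω v r 2)
      flanked = occursAt-++ k (factorω v k 2) (factorω-occurs v k 2)
                  (occursAt-++ (k + 2) z (occursAt-shift (occursAt-factor whole fz)) (factorω-occurs v r 2))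

  desubstitution : ∀ {u} → ProperωWrt F u → (Cut : ℕ → Set) → Blocks g u Cut →
                   ∃ Cut → ∃ λ v → ProperωWrt F v × SuffixImage g u v
  desubstitution proper Cut block c =
    let P , v , img = parse g _ Cut block c
    in (λ i → v (i + 2)) , proper-preimage (ImageAt-proper img proper) ,
       ImageAt⇒SuffixImage (ImageAt-drop 2 img)

𝟎∈? : (w : Word) → Maybe (𝟎 ∈ w)
𝟎∈? w = dec⇒maybe (_∈?_ _≟_ 𝟎 w)

some-𝟎 : ∀ {F u} → ProperωWrt F u → (∀ w → length w ≡ 5 → Improper F w ⊎ 𝟎 ∈ w) → ∃ λ m → u m ≡ 𝟎
some-𝟎 proper zeros = ∈-factorω 0 5 (factorω-satisfies proper zeros 0)

f-uniform : ∀ a → count 𝟎 (f a) ≡ 1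
f-uniform 𝟎 = refl
f-uniform 𝟏 = refl
f-uniform 𝟐 = refl

f-context : ImproperInContext f forbidden
f-context = checkImproperInContext-sound f forbidden _

FBlock : Word → Set
FBlock w = head w ≡ just 𝟎 → ∃₂ λ a rest → w ≡ f a ++ 𝟎 ∷ rest

𝟎-windows : ∀ w → length w ≡ 5 → Improper forbidden w ⊎ 𝟎 ∈ w
𝟎-windows = checkOnProperWords-sound forbidden 5 𝟎∈? _

f-block? : (w : Word) → Maybe (FBlock w)
f-block? (𝟎 ∷ 𝟏 ∷ 𝟐 ∷ 𝟏 ∷ 𝟎 ∷ rest) = just λ _ → 𝟎 , rest , refl
f-block? (𝟎 ∷ 𝟐 ∷ 𝟏 ∷ 𝟎 ∷ rest) = just λ _ → 𝟏 , rest , refl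
f-block? (𝟎 ∷ 𝟏 ∷ 𝟎 ∷ rest) = just λ _ → 𝟐 , rest , refl
f-block? (𝟏 ∷ _) = just λ ()
f-block? (𝟐 ∷ _) = just λ ()
f-block? _ = nothing

f-block-windows : ∀ w → length w ≡ 6 → Improper forbidden w ⊎ FBlock w
f-block-windows = checkOnProperWords-sound forbidden 6 f-block? _

f-block-at-𝟎 : ∀ {u} → Properω u → Blocks f u (λ j → u j ≡ 𝟎)
f-block-at-𝟎 {u} proper {j} uj≡𝟎 =
  let a , rest , e = factorω-satisfies proper f-block-windows j (cong just uj≡𝟎)
      o₁ , o₂ = occursAt-++⁻ j (f a) (subst (OccursAt u j) e (factorω-occurs u j 6))
  in a , o₁ , ∷-injectiveˡ o₂

h-uniform : ∀ a → count 𝟎 (h a) ≡ 1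
h-uniform 𝟎 = refl
h-uniform 𝟏 = refl
h-uniform 𝟐 = refl

h-context : ImproperInContext h forbiddenᴿ
h-context = checkImproperInContext-sound h forbiddenᴿ _

HBlock : Word → Set
HBlock w = head w ≡ just 𝟎 → ∃₂ λ a rest → w ≡ 𝟎 ∷ h a ++ rest

𝟎-windowsᴿ : ∀ w → length w ≡ 5 → Improper forbiddenᴿ w ⊎ 𝟎 ∈ w
𝟎-windowsᴿ = checkOnProperWords-sound forbiddenᴿ 5 𝟎∈? _

h-block? : (w : Word) → Maybe (HBlock w)
h-block? (𝟎 ∷ 𝟏 ∷ 𝟐 ∷ 𝟏 ∷ 𝟎 ∷ rest) = just λ _ → 𝟎 , rest , refl
h-block? (𝟎 ∷ 𝟏 ∷ 𝟐 ∷ 𝟎 ∷ rest) = just λ _ → 𝟏 , rest , refl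
h-block? (𝟎 ∷ 𝟏 ∷ 𝟎 ∷ rest) = just λ _ → 𝟐 , rest , refl
h-block? (𝟏 ∷ _) = just λ ()
h-block? (𝟐 ∷ _) = just λ ()
h-block? _ = nothing

h-ends-with-𝟎 : ∀ {u m} a rest → OccursAt u m (𝟎 ∷ h a ++ rest) → u (m + length (h a)) ≡ 𝟎
h-ends-with-𝟎 𝟎 _ o = ∷-injectiveˡ (proj₂ (occursAt-++⁻ _ (𝟎 ∷ 𝟏 ∷ 𝟐 ∷ 𝟏 ∷ []) o))
h-ends-with-𝟎 𝟏 _ o = ∷-injectiveˡ (proj₂ (occursAt-++⁻ _ (𝟎 ∷ 𝟏 ∷ 𝟐 ∷ []) o))
h-ends-with-𝟎 𝟐 _ o = ∷-injectiveˡ (proj₂ (occursAt-++⁻ _ (𝟎 ∷ 𝟏 ∷ []) o))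

-- Each h a ends in 𝟎, so the h-blocks of u begin right after its 𝟎s.
AfterZero : ωWord → ℕ → Set
AfterZero u j = ∃ λ m → j ≡ suc m × u m ≡ 𝟎

h-block-windows : ∀ w → length w ≡ 5 → Improper forbiddenᴿ w ⊎ HBlock w
h-block-windows = checkOnProperWords-sound forbiddenᴿ 5 h-block? _

h-block-after-𝟎 : ∀ {u} → ProperωWrt forbiddenᴿ u → Blocks h u (AfterZero u)
h-block-after-𝟎 {u} proper (m , refl , um≡𝟎) =
  let a , rest , e = factorω-satisfies proper h-block-windows m (cong just um≡𝟎)
      o = subst (OccursAt u m) e (factorω-occurs u m 5)
  in a , proj₁ (occursAt-++⁻ (suc m) (h a) (∷-injectiveʳ o)) ,
     m + length (h a) , refl , h-ends-with-𝟎 a rest o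

after-some-𝟎 : ∀ {u} → ProperωWrt forbiddenᴿ u → ∃ (AfterZero u)
after-some-𝟎 proper = let m , um≡𝟎 = some-𝟎 proper 𝟎-windowsᴿ in suc m , m , refl , um≡𝟎

theorem1 : (∀ (u : ωWord) → Properω u → ∃ λ v → Properω v × SuffixImage f u v)
         × (∀ (u : ωWord) → Antiproperω u → ∃ λ v → Antiproperω v × SuffixImage h u v)
theorem1 = f-desubstitution , h-desubstitution
  where
  f-desubstitution : ∀ u → Properω u → ∃ λ v → Properω v × SuffixImage f u v
  f-desubstitution u proper =
    desubstitution f-uniform f-context proper (λ j → u j ≡ 𝟎) (f-block-at-𝟎 proper) (some-𝟎 proper 𝟎-windows)

  h-desubstitution : ∀ u → Antiproperω u → ∃ λ v → Antiproperω v × SuffixImage h u v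
  h-desubstitution u anti =
    let v , properᴿ-v , suffix =
          desubstitution h-uniform h-context properᴿ (AfterZero u) (h-block-after-𝟎 properᴿ) (after-some-𝟎 properᴿ)
    in v , (λ i n → properᴿ⇒antiproper (properᴿ-v i n)) , suffix
    where
    properᴿ : ProperωWrt forbiddenᴿ u
    properᴿ i n = antiproper⇒properᴿ (anti i n)
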